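{- Let $\mathfrak a=u/w$ with $u,w$ positive integers, $\gcd(u,w)=1$, $w\mid N$, and let $a,d$ be positive integers with $ad=n$, $a\ne d$. Let $$P=\frac1{\sqrt n}\sigma_{\mathfrak a}\begin{pmatrix}a&b\\0&d\end{pmatrix}\sigma_{\mathfrak a}^{ -1}$$ be a hyperbolic element of $\Gamma^*$ with $P(\mathfrak a)=\mathfrak a$ and $\Gamma_P=\{1_2\}$. Then there exists a number $b'$ such that $P'=\frac1{\sqrt n}\sigma_{\mathfrak a}\begin{pmatrix}d&b'\\0&a\end{pmatrix}\sigma_{\mathfrak a}^{ -1}$ is a hyperbolic element of $\Gamma^*$ with $P'(\mathfrak a)=\mathfrak a$, $\Gamma_{P'}=\{1_2\}$, and $P$ is $\Gamma_0(N)$-conjugate to $P'$, if and only if the two fixed points of $P$ are $\Gamma_0(N)$-equivalent.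
   Context: $N>1$ is an integer that is not square free, $n$ a positive integer with $\gcd(n,N)=1$. $\Gamma_0(N)=\{\begin{pmatrix}\alpha&\beta\\ \gamma&\delta\end{pmatrix}\in SL_2(\mathbb Z):N\mid\gamma\}$ acts on the upper half-plane by Möbius transformations. $\Gamma^*=\bigcup_{ad=n,\,a,d>0,\,0\le b<d}\frac1{\sqrt n}\begin{pmatrix}d&-b\\0&a\end{pmatrix}\Gamma_0(N)$. For $T\in\Gamma^*$, $\Gamma_T$ is the set of elements of $\Gamma_0(N)$ commuting with $T$. $\sigma_{\mathfrak a}=\begin{pmatrix}\mathfrak a\sqrt M&0\\ \sqrt M&1/(\mathfrak a\sqrt M)\end{pmatrix}$ with $M=\operatorname{lcm}(w^2,N)$. -}

module Defs where

open import Data.Nat as ℕ using (ℕ)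
open import Data.Integer as ℤ using (ℤ; +_; +0; +[1+_]; -[1+_])
open import Data.Rational as Q using (ℚ; mkℚ; 0ℚ; 1ℚ)
open import Data.Nat.LCM using (lcm)
open import Data.Nat.Divisibility using (_∣_)
open import Data.Product using (Σ; ∃; _×_; _,_)
open import Data.Sum using (_⊎_)
open import Relation.Binary.PropositionalEquality using (_≡_)
open import Relation.Nullary using (¬_)

ℕ→ℚ : ℕ → ℚ
ℕ→ℚ k = (+ k) Q./ 1

ℤ→ℚ : ℤ → ℚ
ℤ→ℚ z = z Q./ 1

IsInt : ℚ → Set
IsInt q = Σ ℤ λ k → q ≡ ℤ→ℚ k

-- multiplicative inverse of a rational (only ever applied to nonzero
-- arguments; the value at 0 is an irrelevant convention)
qinv : ℚ → ℚ
qinv p@(mkℚ +0       _ _) = 0ℚ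
qinv p@(mkℚ +[1+ _ ] _ _) = Q.1/ p
qinv p@(mkℚ -[1+ _ ] _ _) = Q.1/ p

record Mat : Set where
  constructor mat
  field
    m11 m12 m21 m22 : ℚ
open Mat public

infixl 7 _⊗_
_⊗_ : Mat → Mat → Mat
mat a b c d ⊗ mat a' b' c' d' =
  mat (a Q.* a' Q.+ b Q.* c') (a Q.* b' Q.+ b Q.* d')
      (c Q.* a' Q.+ d Q.* c') (c Q.* b' Q.+ d Q.* d')

scal : ℚ → Mat → Mat
scal k (mat a b c d) = mat (k Q.* a) (k Q.* b) (k Q.* c) (k Q.* d)

det : Mat → ℚ
det (mat a b c d) = a Q.* d Q.- b Q.* c

tr : Mat → ℚ
tr (mat a b c d) = a Q.+ d

I₂ : Mat
I₂ = mat 1ℚ 0ℚ 0ℚ 1ℚ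

-I₂ : Mat
-I₂ = mat (Q.- 1ℚ) 0ℚ 0ℚ (Q.- 1ℚ)

inv : Mat → Mat
inv A@(mat a b c d) = scal (qinv (det A)) (mat d (Q.- b) (Q.- c) a)

IntMat : Mat → Set
IntMat (mat a b c d) = IsInt a × IsInt b × IsInt c × IsInt d

InΓ₀ : ℕ → Mat → Set
InΓ₀ N g = IntMat g × det g ≡ 1ℚ × (Σ ℤ λ k → m21 g ≡ ℕ→ℚ N Q.* ℤ→ℚ k)

-- Γ*.  An element T of Γ* is (1/√n)·Tₛ; we represent T by the rational
-- matrix Tₛ = √n·T.  Then T ∈ Γ* iff Tₛ ∈ ⋃ [[d,-b],[0,a]] Γ₀(N).

InΓ* : ℕ → ℕ → Mat → Set
InΓ* N n Tₛ =
  Σ ℕ λ a → Σ ℕ λ d → Σ ℕ λ b → Σ Mat λ g →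
    0 ℕ.< a × 0 ℕ.< d × a ℕ.* d ≡ n × b ℕ.< d × InΓ₀ N g ×
    Tₛ ≡ mat (ℕ→ℚ d) (Q.- ℕ→ℚ b) 0ℚ (ℕ→ℚ a) ⊗ g

-- T = (1/√n)Tₛ is hyperbolic iff |tr T| > 2 iff (tr Tₛ)² > 4n
Hyperbolic : ℕ → Mat → Set
Hyperbolic n Tₛ = tr Tₛ Q.* tr Tₛ Q.> ℕ→ℚ (4 ℕ.* n)

-- Γ_T = {g ∈ Γ₀(N) : gT = Tg} is trivial, i.e. {±1₂}
-- (commuting with T is the same as commuting with Tₛ)
TrivialΓ : ℕ → Mat → Set
TrivialΓ N Tₛ = ∀ g → InΓ₀ N g → g ⊗ Tₛ ≡ Tₛ ⊗ g → (g ≡ I₂ ⊎ g ≡ -I₂)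

-- Points of ℙ¹(ℚ) = ℚ ∪ {∞}: nonzero vectors (x,y) up to scaling,
-- x/y ∈ ℚ for y ≠ 0 and (1,0) = ∞.  Möbius action by matrices.

record Pt : Set where
  constructor pt
  field
    px py : ℚ
    nz    : ¬ (px ≡ 0ℚ × py ≡ 0ℚ)
open Pt public

_≈P_ : Pt → Pt → Set
p ≈P q = px p Q.* py q ≡ py p Q.* px q

act : Mat → Pt → ℚ × ℚ
act (mat a b c d) p = (a Q.* px p Q.+ b Q.* py p) , (c Q.* px p Q.+ d Q.* py p)

MapsTo : Mat → Pt → Pt → Set
MapsTo A p q with act A p
... | (x , y) = x Q.* py q ≡ y Q.* px q

Fixes : Mat → Pt → Set
Fixes A p = MapsTo A p p

ratPt : ℚ → Pt
ratPt q = pt q 1ℚ λ { (_ , ()) }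

Γ₀Equiv : ℕ → Pt → Pt → Set
Γ₀Equiv N p q = Σ Mat λ g → InΓ₀ N g × MapsTo g p q

-- σ_𝔞 = √M · S with S = [[𝔞, 0], [1, 1/(𝔞M)]], M = lcm(w², N), 𝔞 = u/w.
-- Conjugation is insensitive to the scalar √M, so
-- σ_𝔞 X σ_𝔞⁻¹ = S X S⁻¹.

Mσ : ℕ → ℕ → ℕ
Mσ w N = lcm (w ℕ.* w) N

𝔞ℚ : ℕ → ℕ → ℚ
𝔞ℚ u w = ℕ→ℚ u Q.* qinv (ℕ→ℚ w)

Sσ : ℕ → ℕ → ℕ → Mat
Sσ u w N = mat (𝔞ℚ u w) 0ℚ 1ℚ (qinv (𝔞ℚ u w Q.* ℕ→ℚ (Mσ w N)))

-- √n · (1/√n) σ_𝔞 [[x, y], [0, z]] σ_𝔞⁻¹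
conjσ : ℕ → ℕ → ℕ → (x : ℕ) → ℚ → (z : ℕ) → Mat
conjσ u w N x y z = Sσ u w N ⊗ mat (ℕ→ℚ x) y 0ℚ (ℕ→ℚ z) ⊗ inv (Sσ u w N)

NotSquareFree : ℕ → Set
NotSquareFree N = Σ ℕ λ p → 1 ℕ.< p × (p ℕ.* p) ∣ N

{-# OPTIONS --safe #-}
-- Up to the factor 1/√n, P = σ [[a, b], [0, d]] σ⁻¹ has the eigenvector σ e₁ ∼ 𝔞 for the
-- eigenvalue a and σ (b, d − a) for the eigenvalue d; since a ≠ d, its fixed points in ℙ¹(ℚ)
-- are exactly these two eigenlines.  If g ∈ Γ₀(N) conjugates P to σ [[d, b′], [0, a]] σ⁻¹,
-- then 𝔞 is the d-eigenline of gPg⁻¹, so g⁻¹𝔞 is the d-eigenline of P and g carries one fixed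
-- point of P to the other.  Conversely, if g ∈ Γ₀(N) maps the d-eigenline of P to 𝔞, then gPg⁻¹
-- has 𝔞 as d-eigenline and trace a + d, hence is σ [[d, b′], [0, a]] σ⁻¹ for some b′.  It lies
-- in Γ* because for gcd(n, N) = 1 the set Γ* consists of all integral matrices of determinant n
-- whose lower-left entry is divisible by N (Hermite normal form), and being hyperbolic and having
-- trivial Γ_P are invariant under conjugation.
module Submission where

open import Defs
open import Data.Rational using (ℚ)
open import Data.Product using (Σ; _×_)
open import Relation.Binary.PropositionalEquality using (_≡_; _≢_)
open import Relation.Nullary using (¬_)

module IntegerMatrices where

  open import Data.Empty using (⊥-elim)
  open import Data.Integer using (ℤ; +_; 0ℤ; 1ℤ; -1ℤ; ∣_∣; _+_; _*_; _-_; -_)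
  import Data.Integer.Coprimality as ℤ
  open import Data.Integer.Divisibility.Signed using (_∣_; divides; ∣ᵤ⇒∣; ∣⇒∣ᵤ)
  open import Data.Integer.DivMod using (_/ℕ_; _%ℕ_; n%ℕd<d; a≡a%ℕn+[a/ℕn]*n)
  import Data.Integer.GCD as ℤ
  import Data.Integer.Properties as ℤ
  open import Data.Integer.Tactic.RingSolver using () renaming (ring to ℤ-ring)
  open import Data.Nat as ℕ using (ℕ)
  import Data.Nat.Coprimality as ℕ
  import Data.Nat.Divisibility as ℕ
  import Data.Nat.GCD as ℕ
  import Data.Nat.Properties as ℕ
  open import Data.Product using (_,_; proj₁; proj₂)
  open import Data.Sum using (inj₁; inj₂)
  open import Relation.Binary.PropositionalEquality
    using (refl; sym; trans; cong; cong₂; subst; module ≡-Reasoning)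
  open import Relation.Nullary using (yes; no)
  open import Tactic.RingSolver using (solve-∀)

  record Matℤ : Set where
    constructor matℤ
    field
      a b c d : ℤ

  matℤ-cong : ∀ {a b c d a′ b′ c′ d′} → a ≡ a′ → b ≡ b′ → c ≡ c′ → d ≡ d′ →
              matℤ a b c d ≡ matℤ a′ b′ c′ d′
  matℤ-cong refl refl refl refl = refl

  infixl 7 _⊗ℤ_
  _⊗ℤ_ : Matℤ → Matℤ → Matℤ
  matℤ a b c d ⊗ℤ matℤ a′ b′ c′ d′ =
    matℤ (a * a′ + b * c′) (a * b′ + b * d′) (c * a′ + d * c′) (c * b′ + d * d′)

  detℤ : Matℤ → ℤ
  detℤ (matℤ a b c d) = a * d - b * c

  upperℤ : ℕ → ℕ → ℕ → Matℤ
  upperℤ d b a = matℤ (+ d) (- + b) 0ℤ (+ a)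

  ∣i∣-multiple : ∀ i → Σ ℤ λ σ → + ∣ i ∣ ≡ σ * i
  ∣i∣-multiple i with ℤ.+∣i∣≡i⊎+∣i∣≡-i i
  ... | inj₁ ∣i∣≡i  = 1ℤ , trans ∣i∣≡i (sym (ℤ.*-identityˡ i))
  ... | inj₂ ∣i∣≡-i = -1ℤ , trans ∣i∣≡-i (sym (ℤ.-1*i≡-i i))

  pos-lift : ∀ g y n x m → g ℕ.+ y ℕ.* n ≡ x ℕ.* m → + g + + y * + n ≡ + x * + m
  pos-lift g y n x m eq = begin
    + g + + y * + n      ≡⟨ cong (_+_ (+ g)) (ℤ.pos-* y n) ⟨
    + g + + (y ℕ.* n)    ≡⟨ ℤ.pos-+ g (y ℕ.* n) ⟨
    + (g ℕ.+ y ℕ.* n)    ≡⟨ cong +_ eq ⟩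
    + (x ℕ.* m)          ≡⟨ ℤ.pos-* x m ⟩
    + x * + m            ∎
    where open ≡-Reasoning

  bézout-with-signs : ∀ g i j x y → g ℕ.+ x ℕ.* ∣ i ∣ ≡ y ℕ.* ∣ j ∣ →
                      Σ ℤ λ x′ → Σ ℤ λ y′ → x′ * i + y′ * j ≡ + g
  bézout-with-signs g i j x y eq = - (+ x * σ) , + y * τ , (begin
    - (+ x * σ) * i + + y * τ * j        ≡⟨ regroup (+ x) σ i (+ y) τ j ⟩
    + y * (τ * j) - + x * (σ * i)        ≡⟨ cong₂ (λ m n → + y * n - + x * m) ∣i∣≡σi ∣j∣≡τj ⟨
    + y * + ∣ j ∣ - + x * + ∣ i ∣        ≡⟨ cong (_- + x * + ∣ i ∣) (pos-lift g x (∣ i ∣) y (∣ j ∣) eq) ⟨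
    + g + + x * + ∣ i ∣ - + x * + ∣ i ∣  ≡⟨ cancel (+ g) (+ x * + ∣ i ∣) ⟩
    + g                                  ∎)
    where
    open ≡-Reasoning
    σ = proj₁ (∣i∣-multiple i)
    ∣i∣≡σi = proj₂ (∣i∣-multiple i)
    τ = proj₁ (∣i∣-multiple j)
    ∣j∣≡τj = proj₂ (∣i∣-multiple j)
    regroup : ∀ x σ i y τ j → - (x * σ) * i + y * τ * j ≡ y * (τ * j) - x * (σ * i)
    regroup = solve-∀ ℤ-ring
    cancel : ∀ g n → g + n - n ≡ g
    cancel = solve-∀ ℤ-ring

  ℤ-bézout : ∀ i j → Σ ℤ λ x → Σ ℤ λ y → x * i + y * j ≡ ℤ.gcd i j
  ℤ-bézout i j with ℕ.Bézout.identity (ℕ.gcd-GCD (∣ i ∣) (∣ j ∣))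
  ... | ℕ.Bézout.-+ x y eq = bézout-with-signs _ i j x y eq
  ... | ℕ.Bézout.+- x y eq with bézout-with-signs _ j i y x eq
  ...   | y′ , x′ , y′j+x′i≡gcd = x′ , y′ , trans (ℤ.+-comm (x′ * i) (y′ * j)) y′j+x′i≡gcd

  record ContentDecomposition (r s : ℤ) : Set where
    field
      content      : ℕ
      r′ s′ x y    : ℤ
      r≡content*r′ : r ≡ + content * r′
      s≡content*s′ : s ≡ + content * s′
      unimodular   : x * s′ - y * r′ ≡ 1ℤ

  content-decomposition : ∀ r s → ContentDecomposition r s
  content-decomposition r s with ℕ.gcd (∣ r ∣) (∣ s ∣) ℕ.≟ 0
  ... | yes gcd≡0 = record
    { content = 0 ; r′ = 0ℤ ; s′ = 1ℤ ; x = 1ℤ ; y = 0ℤ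
    ; r≡content*r′ = ℤ.gcd[i,j]≡0⇒i≡0 r s (cong +_ gcd≡0)
    ; s≡content*s′ = ℤ.gcd[i,j]≡0⇒j≡0 {r} (cong +_ gcd≡0)
    ; unimodular = refl }
  ... | no gcd≢0 = record
    { content = g ; r′ = r′ ; s′ = s′ ; x = v ; y = - u
    ; r≡content*r′ = trans r≡r′g (ℤ.*-comm r′ (+ g))
    ; s≡content*s′ = trans s≡s′g (ℤ.*-comm s′ (+ g))
    ; unimodular = trans (swap u v r′ s′) ur′+vs′≡1 }
    where
    open ≡-Reasoning
    g = ℕ.gcd (∣ r ∣) (∣ s ∣)
    instance
      _ = ℕ.≢-nonZero gcd≢0
    open _∣_ (∣ᵤ⇒∣ {ℤ.gcd r s} {r} (ℤ.gcd[i,j]∣i r s)) renaming (quotient to r′; equality to r≡r′g)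
    open _∣_ (∣ᵤ⇒∣ {ℤ.gcd r s} {s} (ℤ.gcd[i,j]∣j r s)) renaming (quotient to s′; equality to s≡s′g)
    u = proj₁ (ℤ-bézout r s)
    v = proj₁ (proj₂ (ℤ-bézout r s))
    ur′+vs′≡1 : u * r′ + v * s′ ≡ 1ℤ
    ur′+vs′≡1 = ℤ.*-cancelˡ-≡ (+ g) (u * r′ + v * s′) 1ℤ (begin
      + g * (u * r′ + v * s′)      ≡⟨ distribute (+ g) u r′ v s′ ⟩
      u * (r′ * + g) + v * (s′ * + g) ≡⟨ cong₂ (λ r s → u * r + v * s) r≡r′g s≡s′g ⟨
      u * r + v * s                ≡⟨ proj₂ (proj₂ (ℤ-bézout r s)) ⟩
      + g                          ≡⟨ ℤ.*-identityʳ (+ g) ⟨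
      + g * 1ℤ                     ∎)
      where
      distribute : ∀ g u r′ v s′ → g * (u * r′ + v * s′) ≡ u * (r′ * g) + v * (s′ * g)
      distribute = solve-∀ ℤ-ring
    swap : ∀ u v r′ s′ → v * s′ - - u * r′ ≡ u * r′ + v * s′
    swap = solve-∀ ℤ-ring

  column-reduction : ∀ p q r′ s′ x y t a → x * s′ - y * r′ ≡ 1ℤ →
    let D = p * s′ - q * r′ in
    matℤ p q (a * r′) (a * s′)
      ≡ matℤ D (q * x - p * y + t * D) 0ℤ a ⊗ℤ matℤ (x - t * r′) (y - t * s′) r′ s′
  column-reduction p q r′ s′ x y t a unimodular = matℤ-cong
    (trans (sym (times-unimodular p)) (first p q r′ s′ x y t))
    (trans (sym (times-unimodular q)) (second p q r′ s′ x y t))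
    (sym (lower a r′ (x - t * r′)))
    (sym (lower a s′ (y - t * s′)))
    where
    times-unimodular : ∀ z → z * (x * s′ - y * r′) ≡ z
    times-unimodular z = trans (cong (z *_) unimodular) (ℤ.*-identityʳ z)
    first : ∀ p q r′ s′ x y t → p * (x * s′ - y * r′)
      ≡ (p * s′ - q * r′) * (x - t * r′) + (q * x - p * y + t * (p * s′ - q * r′)) * r′
    first = solve-∀ ℤ-ring
    second : ∀ p q r′ s′ x y t → q * (x * s′ - y * r′)
      ≡ (p * s′ - q * r′) * (y - t * s′) + (q * x - p * y + t * (p * s′ - q * r′)) * s′
    second = solve-∀ ℤ-ring
    lower : ∀ a r z → 0ℤ * z + a * r ≡ a * r
    lower = solve-∀ ℤ-ring

  positive-factors : ∀ a d → 0 ℕ.< a ℕ.* d → 0 ℕ.< a × 0 ℕ.< d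
  positive-factors (ℕ.suc _) (ℕ.suc _) _ = ℕ.z<s , ℕ.z<s
  positive-factors (ℕ.suc a) 0 0<a*0 = ⊥-elim (ℕ.<-irrefl (sym (ℕ.*-zeroʳ a)) 0<a*0)

  remainder-shift : ∀ w d .{{_ : ℕ.NonZero d}} → w + ((- w) /ℕ d) * + d ≡ - + ((- w) %ℕ d)
  remainder-shift w d = begin
    w + t * + d                        ≡⟨ negate w (t * + d) ⟩
    - (- w - t * + d)                  ≡⟨ cong (λ e → - (e - t * + d)) (a≡a%ℕn+[a/ℕn]*n (- w) d) ⟩
    - (+ ((- w) %ℕ d) + t * + d - t * + d) ≡⟨ cong -_ (cancel (+ ((- w) %ℕ d)) (t * + d)) ⟩
    - + ((- w) %ℕ d)                   ∎
    where
    open ≡-Reasoning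
    t = (- w) /ℕ d
    negate : ∀ w u → w + u ≡ - (- w - u)
    negate = solve-∀ ℤ-ring
    cancel : ∀ b u → b + u - u ≡ b
    cancel = solve-∀ ℤ-ring

  ∣a*r⇒∣r : ∀ {N n} a d r → ℕ.gcd n N ≡ 1 → a ℕ.* d ≡ n → + N ∣ + a * r → + N ∣ r
  ∣a*r⇒∣r {N} {n} a d r n⊥N a*d≡n N∣ar = ∣ᵤ⇒∣ (ℤ.coprime-divisor (+ N) (+ a) r N⊥a (∣⇒∣ᵤ N∣ar))
    where
    N⊥a : ℕ.Coprime N a
    N⊥a (i∣N , i∣a) =
      ℕ.gcd≡1⇒coprime n⊥N (ℕ.∣-trans i∣a (ℕ.divides d (trans (sym a*d≡n) (ℕ.*-comm a d))) , i∣N)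

  record HermiteDecomposition (N n : ℕ) (M : Matℤ) : Set where
    field
      a d b         : ℕ
      g             : Matℤ
      0<a           : 0 ℕ.< a
      0<d           : 0 ℕ.< d
      a*d≡n         : a ℕ.* d ≡ n
      b<d           : b ℕ.< d
      det-g         : detℤ g ≡ 1ℤ
      N∣lower-left  : + N ∣ Matℤ.c g
      factorisation : M ≡ upperℤ d b a ⊗ℤ g

  -- Factor the bottom row as a·(r′, s′), complete (r′, s′) to g ∈ SL₂(ℤ), and shear g so that
  -- the upper-right entry of M g⁻¹ lies in (−d, 0].
  hermite : ∀ {N n} → 0 ℕ.< n → ℕ.gcd n N ≡ 1 → ∀ M → + N ∣ Matℤ.c M → detℤ M ≡ + n →
            HermiteDecomposition N n M
  hermite {N} {n} 0<n n⊥N (matℤ p q r s) N∣r det≡n = record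
    { a             = a
    ; d             = d
    ; b             = e %ℕ d
    ; g             = g
    ; 0<a           = 0<a
    ; 0<d           = 0<d
    ; a*d≡n         = a*d≡n
    ; b<d           = n%ℕd<d e d
    ; det-g         = trans (shear-det x y r′ s′ t) unimodular
    ; N∣lower-left  = ∣a*r⇒∣r a d r′ n⊥N a*d≡n (subst (+ N ∣_) r≡content*r′ N∣r)
    ; factorisation = factorisation
    }
    where
    open ≡-Reasoning
    open ContentDecomposition (content-decomposition r s) renaming (content to a)
    D = p * s′ - q * r′
    aD≡n : + a * D ≡ + n
    aD≡n = begin
      + a * D                          ≡⟨ distribute (+ a) p q r′ s′ ⟩
      p * (+ a * s′) - q * (+ a * r′)  ≡⟨ cong₂ (λ s r → p * s - q * r) s≡content*s′ r≡content*r′ ⟨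
      p * s - q * r                    ≡⟨ det≡n ⟩
      + n                              ∎
      where
      distribute : ∀ a p q r′ s′ → a * (p * s′ - q * r′) ≡ p * (a * s′) - q * (a * r′)
      distribute = solve-∀ ℤ-ring
    d = ∣ D ∣
    a*d≡n : a ℕ.* d ≡ n
    a*d≡n = trans (sym (ℤ.abs-* (+ a) D)) (cong ∣_∣ aD≡n)
    0<a : 0 ℕ.< a
    0<a = proj₁ (positive-factors a d (subst (0 ℕ.<_) (sym a*d≡n) 0<n))
    0<d : 0 ℕ.< d
    0<d = proj₂ (positive-factors a d (subst (0 ℕ.<_) (sym a*d≡n) 0<n))
    instance
      _ = ℕ.>-nonZero 0<a
      _ = ℕ.>-nonZero 0<d
    D≡d : D ≡ + d
    D≡d = ℤ.*-cancelˡ-≡ (+ a) D (+ d) (trans aD≡n (trans (cong +_ (sym a*d≡n)) (ℤ.pos-* a d)))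
    e = - (q * x - p * y)
    t = e /ℕ d
    g = matℤ (x - t * r′) (y - t * s′) r′ s′
    shear-det : ∀ x y r′ s′ t → (x - t * r′) * s′ - (y - t * s′) * r′ ≡ x * s′ - y * r′
    shear-det = solve-∀ ℤ-ring
    factorisation : matℤ p q r s ≡ upperℤ d (e %ℕ d) a ⊗ℤ g
    factorisation = begin
      matℤ p q r s                                 ≡⟨ matℤ-cong refl refl r≡content*r′ s≡content*s′ ⟩
      matℤ p q (+ a * r′) (+ a * s′)               ≡⟨ column-reduction p q r′ s′ x y t (+ a) unimodular ⟩
      matℤ D (q * x - p * y + t * D) 0ℤ (+ a) ⊗ℤ g
        ≡⟨ cong (λ D → matℤ D (q * x - p * y + t * D) 0ℤ (+ a) ⊗ℤ g) D≡d ⟩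
      matℤ (+ d) (q * x - p * y + t * + d) 0ℤ (+ a) ⊗ℤ g
        ≡⟨ cong (λ B → matℤ (+ d) B 0ℤ (+ a) ⊗ℤ g) (remainder-shift (q * x - p * y) d) ⟩
      upperℤ d (e %ℕ d) a ⊗ℤ g                     ∎

module RationalMatrices where

  open import Algebra.Properties.Group using (x∙y⁻¹≈ε⇒x≈y)
  open import Data.Empty using (⊥-elim)
  open import Data.Integer as ℤ using (ℤ; +_; +0; +[1+_]; -[1+_]; 0ℤ)
  open import Data.Integer.Divisibility.Signed
    using (_∣_; divides; ∣m⇒∣-m; ∣m⇒∣m*n; ∣n⇒∣m*n; ∣m∣n⇒∣m+n)
  import Data.Integer.Properties as ℤ
  open import Data.Maybe.Base using (just; nothing)
  open import Data.Nat as ℕ using (ℕ)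
  import Data.Nat.Coprimality as Cop
  import Data.Nat.GCD as ℕ
  open import Data.Nat.LCM using (gcd*lcm)
  import Data.Nat.Properties as ℕ
  open import Data.Product using (_,_; proj₁; proj₂; swap)
  open import Data.Rational as ℚ using (mkℚ; 0ℚ; 1ℚ; _+_; _*_; _-_; -_)
  import Data.Rational.Properties as ℚ
  open import Data.Sum using (_⊎_; inj₁; inj₂; [_,_]′)
  import Data.Sum as Sum
  open import Level using (0ℓ)
  open import Relation.Binary.PropositionalEquality
    using (refl; sym; trans; cong; cong₂; subst; module ≡-Reasoning)
  open import Relation.Nullary using (yes; no)
  open import Tactic.RingSolver using (solve-∀)
  import Tactic.RingSolver.Core.AlmostCommutativeRing as ACR
  open IntegerMatrices

  ℚ-ring : ACR.AlmostCommutativeRing 0ℓ 0ℓ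
  ℚ-ring = ACR.fromCommutativeRing ℚ.+-*-commutativeRing λ
    { (mkℚ +0 0 _) → just refl ; _ → nothing }

  p-q≡0⇒p≡q : ∀ p q → p - q ≡ 0ℚ → p ≡ q
  p-q≡0⇒p≡q = x∙y⁻¹≈ε⇒x≈y ℚ.+-0-group

  qinv-inverseˡ : ∀ p → p ≢ 0ℚ → qinv p * p ≡ 1ℚ
  qinv-inverseˡ (mkℚ +0 _ _)         p≢0 = ⊥-elim (p≢0 (ℚ.↥p≡0⇒p≡0 _ refl))
  qinv-inverseˡ p@(mkℚ +[1+ _ ] _ _) _   = ℚ.*-inverseˡ p
  qinv-inverseˡ p@(mkℚ -[1+ _ ] _ _) _   = ℚ.*-inverseˡ p

  qinv-nonZero : ∀ p → p ≢ 0ℚ → qinv p ≢ 0ℚ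
  qinv-nonZero p p≢0 qinv≡0 = ℚ.1≢0 (begin
    1ℚ          ≡⟨ qinv-inverseˡ p p≢0 ⟨
    qinv p * p  ≡⟨ cong (_* p) qinv≡0 ⟩
    0ℚ * p      ≡⟨ ℚ.*-zeroˡ p ⟩
    0ℚ          ∎)
    where open ≡-Reasoning

  *-qinv-cancelʳ : ∀ p r → r ≢ 0ℚ → p * r * qinv r ≡ p
  *-qinv-cancelʳ p r r≢0 = begin
    p * r * qinv r    ≡⟨ reassoc p r (qinv r) ⟩
    p * (qinv r * r)  ≡⟨ cong (p *_) (qinv-inverseˡ r r≢0) ⟩
    p * 1ℚ            ≡⟨ ℚ.*-identityʳ p ⟩
    p                 ∎
    where
    open ≡-Reasoning
    reassoc : ∀ p r r′ → p * r * r′ ≡ p * (r′ * r)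
    reassoc = solve-∀ ℚ-ring

  *-cancelʳ-≡ : ∀ p q r → r ≢ 0ℚ → p * r ≡ q * r → p ≡ q
  *-cancelʳ-≡ p q r r≢0 pr≡qr = begin
    p               ≡⟨ *-qinv-cancelʳ p r r≢0 ⟨
    p * r * qinv r  ≡⟨ cong (_* qinv r) pr≡qr ⟩
    q * r * qinv r  ≡⟨ *-qinv-cancelʳ q r r≢0 ⟩
    q               ∎
    where open ≡-Reasoning

  p*q≡0⇒p≡0∨q≡0 : ∀ p q → p * q ≡ 0ℚ → p ≡ 0ℚ ⊎ q ≡ 0ℚ
  p*q≡0⇒p≡0∨q≡0 p q pq≡0 with q ℚ.≟ 0ℚ
  ... | yes q≡0 = inj₂ q≡0
  ... | no  q≢0 = inj₁ (*-cancelʳ-≡ p 0ℚ q q≢0 (trans pq≡0 (sym (ℚ.*-zeroˡ q))))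

  p≢0∧q≢0⇒p*q≢0 : ∀ p q → p ≢ 0ℚ → q ≢ 0ℚ → p * q ≢ 0ℚ
  p≢0∧q≢0⇒p*q≢0 p q p≢0 q≢0 pq≡0 = [ p≢0 , q≢0 ]′ (p*q≡0⇒p≡0∨q≡0 p q pq≡0)

  -- ℤ→ℚ i = i / 1 is stuck for a variable i, whereas arithmetic on this normal form computes.
  fromℤ : ℤ → ℚ
  fromℤ i = mkℚ i 0 (Cop.sym (Cop.1-coprimeTo ℤ.∣ i ∣))

  ℤ→ℚ≡fromℤ : ∀ i → ℤ→ℚ i ≡ fromℤ i
  ℤ→ℚ≡fromℤ i = ℚ.↥p/↧p≡p (fromℤ i)

  ℤ→ℚ-injective : ∀ {i j} → ℤ→ℚ i ≡ ℤ→ℚ j → i ≡ j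
  ℤ→ℚ-injective {i} {j} eq = cong ℚ.↥_ (trans (sym (ℤ→ℚ≡fromℤ i)) (trans eq (ℤ→ℚ≡fromℤ j)))

  ℤ→ℚ-+ : ∀ i j → ℤ→ℚ (i ℤ.+ j) ≡ ℤ→ℚ i + ℤ→ℚ j
  ℤ→ℚ-+ i j rewrite ℤ→ℚ≡fromℤ i | ℤ→ℚ≡fromℤ j =
    cong ℤ→ℚ (sym (cong₂ ℤ._+_ (ℤ.*-identityʳ i) (ℤ.*-identityʳ j)))

  ℤ→ℚ-* : ∀ i j → ℤ→ℚ (i ℤ.* j) ≡ ℤ→ℚ i * ℤ→ℚ j
  ℤ→ℚ-* i j rewrite ℤ→ℚ≡fromℤ i | ℤ→ℚ≡fromℤ j = refl

  ℤ→ℚ-neg : ∀ i → ℤ→ℚ (ℤ.- i) ≡ - ℤ→ℚ i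
  ℤ→ℚ-neg i rewrite ℤ→ℚ≡fromℤ i | ℤ→ℚ≡fromℤ (ℤ.- i) = fromℤ-neg i
    where
    fromℤ-neg : ∀ i → fromℤ (ℤ.- i) ≡ - fromℤ i
    fromℤ-neg +0       = refl
    fromℤ-neg +[1+ _ ] = refl
    fromℤ-neg -[1+ _ ] = refl

  ℤ→ℚ-minus : ∀ i j → ℤ→ℚ (i ℤ.- j) ≡ ℤ→ℚ i - ℤ→ℚ j
  ℤ→ℚ-minus i j = trans (ℤ→ℚ-+ i (ℤ.- j)) (cong (_+_ (ℤ→ℚ i)) (ℤ→ℚ-neg j))

  ℤ→ℚ-*+* : ∀ a b c d → ℤ→ℚ (a ℤ.* b ℤ.+ c ℤ.* d) ≡ ℤ→ℚ a * ℤ→ℚ b + ℤ→ℚ c * ℤ→ℚ d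
  ℤ→ℚ-*+* a b c d = trans (ℤ→ℚ-+ (a ℤ.* b) (c ℤ.* d)) (cong₂ _+_ (ℤ→ℚ-* a b) (ℤ→ℚ-* c d))

  ℕ→ℚ-injective : ∀ {m n} → ℕ→ℚ m ≡ ℕ→ℚ n → m ≡ n
  ℕ→ℚ-injective eq = ℤ.+-injective (ℤ→ℚ-injective eq)

  ℕ→ℚ-* : ∀ m n → ℕ→ℚ (m ℕ.* n) ≡ ℕ→ℚ m * ℕ→ℚ n
  ℕ→ℚ-* m n = trans (cong ℤ→ℚ (ℤ.pos-* m n)) (ℤ→ℚ-* (+ m) (+ n))

  ℕ→ℚ-nonZero : ∀ {n} → 0 ℕ.< n → ℕ→ℚ n ≢ 0ℚ
  ℕ→ℚ-nonZero 0<n eq = ℕ.<⇒≢ 0<n (sym (ℕ→ℚ-injective eq))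

  ℚ² : Set
  ℚ² = ℚ × ℚ

  NonZeroᵥ : ℚ² → Set
  NonZeroᵥ (x , y) = ¬ (x ≡ 0ℚ × y ≡ 0ℚ)

  vec : Pt → ℚ²
  vec p = px p , py p

  e₁ : ℚ²
  e₁ = 1ℚ , 0ℚ

  infixr 8 _*ᵥ_
  _*ᵥ_ : ℚ → ℚ² → ℚ²
  k *ᵥ (x , y) = k * x , k * y

  infixl 7 _+ᵥ_
  _+ᵥ_ : ℚ² → ℚ² → ℚ²
  (x , y) +ᵥ (x′ , y′) = x + x′ , y + y′

  *ᵥ-assoc : ∀ k l v → k *ᵥ l *ᵥ v ≡ (k * l) *ᵥ v
  *ᵥ-assoc k l (x , y) = cong₂ _,_ (sym (ℚ.*-assoc k l x)) (sym (ℚ.*-assoc k l y))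

  *ᵥ-identityˡ : ∀ v → 1ℚ *ᵥ v ≡ v
  *ᵥ-identityˡ (x , y) = cong₂ _,_ (ℚ.*-identityˡ x) (ℚ.*-identityˡ y)

  qinv-*ᵥ-cancel : ∀ k v → k ≢ 0ℚ → qinv k *ᵥ k *ᵥ v ≡ v
  qinv-*ᵥ-cancel k v k≢0 = begin
    qinv k *ᵥ k *ᵥ v   ≡⟨ *ᵥ-assoc (qinv k) k v ⟩
    (qinv k * k) *ᵥ v  ≡⟨ cong (_*ᵥ v) (qinv-inverseˡ k k≢0) ⟩
    1ℚ *ᵥ v            ≡⟨ *ᵥ-identityˡ v ⟩
    v                  ∎
    where open ≡-Reasoning

  *ᵥ-comm : ∀ k l v → k *ᵥ l *ᵥ v ≡ l *ᵥ k *ᵥ v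
  *ᵥ-comm k l (x , y) = cong₂ _,_ (identity k l x) (identity k l y)
    where
    identity : ∀ k l x → k * (l * x) ≡ l * (k * x)
    identity = solve-∀ ℚ-ring

  *ᵥ-cancelʳ : ∀ κ μ v → NonZeroᵥ v → κ *ᵥ v ≡ μ *ᵥ v → κ ≡ μ
  *ᵥ-cancelʳ κ μ (x , y) v≢0 κv≡μv with x ℚ.≟ 0ℚ | y ℚ.≟ 0ℚ
  ... | no x≢0  | _       = *-cancelʳ-≡ κ μ x x≢0 (cong proj₁ κv≡μv)
  ... | yes _   | no y≢0  = *-cancelʳ-≡ κ μ y y≢0 (cong proj₂ κv≡μv)
  ... | yes x≡0 | yes y≡0 = ⊥-elim (v≢0 (x≡0 , y≡0))

  cross : ℚ² → ℚ² → ℚ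
  cross (x , y) (x′ , y′) = x * y′ - y * x′

  -- An equation rather than cross u v ≡ 0ℚ, so that ≈P and MapsTo of Defs unfold to it.
  infix 4 _∥_
  _∥_ : ℚ² → ℚ² → Set
  (x , y) ∥ (x′ , y′) = x * y′ ≡ y * x′

  ∥⇒cross≡0 : ∀ u v → u ∥ v → cross u v ≡ 0ℚ
  ∥⇒cross≡0 (x , y) (x′ , y′) eq = trans (cong (_- y * x′) eq) (ℚ.+-inverseʳ (y * x′))

  cross≡0⇒∥ : ∀ u v → cross u v ≡ 0ℚ → u ∥ v
  cross≡0⇒∥ (x , y) (x′ , y′) = p-q≡0⇒p≡q (x * y′) (y * x′)

  ∥-refl : ∀ v → v ∥ v
  ∥-refl (x , y) = ℚ.*-comm x y

  ∥-sym : ∀ u v → u ∥ v → v ∥ u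
  ∥-sym (x , y) (x′ , y′) eq = trans (ℚ.*-comm x′ y) (trans (sym eq) (ℚ.*-comm x y′))

  *ᵥ-∥ : ∀ k v → k *ᵥ v ∥ v
  *ᵥ-∥ k (x , y) = identity k x y
    where
    identity : ∀ k x y → k * x * y ≡ k * y * x
    identity = solve-∀ ℚ-ring

  *ᵥ-∥-*ᵥ : ∀ k l v → k *ᵥ v ∥ l *ᵥ v
  *ᵥ-∥-*ᵥ k l (x , y) = identity k l x y
    where
    identity : ∀ k l x y → k * x * (l * y) ≡ k * y * (l * x)
    identity = solve-∀ ℚ-ring

  ∥⇒≡*ᵥ-first : ∀ x y x′ y′ → x′ ≢ 0ℚ → x * y′ ≡ y * x′ →
                 (x , y) ≡ (x * qinv x′) *ᵥ (x′ , y′)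
  ∥⇒≡*ᵥ-first x y x′ y′ x′≢0 xy′≡yx′ = cong₂ _,_
    (sym (trans (reorder x (qinv x′) x′) (*-qinv-cancelʳ x x′ x′≢0)))
    (sym (begin
      x * qinv x′ * y′  ≡⟨ reorder x (qinv x′) y′ ⟩
      x * y′ * qinv x′  ≡⟨ cong (_* qinv x′) xy′≡yx′ ⟩
      y * x′ * qinv x′  ≡⟨ *-qinv-cancelʳ y x′ x′≢0 ⟩
      y                 ∎))
    where
    open ≡-Reasoning
    reorder : ∀ p q r → p * q * r ≡ p * r * q
    reorder = solve-∀ ℚ-ring

  ∥⇒≡*ᵥ : ∀ u v → NonZeroᵥ v → u ∥ v → Σ ℚ λ k → u ≡ k *ᵥ v
  ∥⇒≡*ᵥ (x , y) (x′ , y′) v≢0 u∥v with x′ ℚ.≟ 0ℚ | y′ ℚ.≟ 0ℚ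
  ... | no x′≢0 | _       = x * qinv x′ , ∥⇒≡*ᵥ-first x y x′ y′ x′≢0 u∥v
  ... | yes _   | no y′≢0 = y * qinv y′ , cong swap (∥⇒≡*ᵥ-first y x y′ x′ y′≢0 (sym u∥v))
  ... | yes x′≡0 | yes y′≡0 = ⊥-elim (v≢0 (x′≡0 , y′≡0))

  ∥-trans : ∀ u v w → NonZeroᵥ v → u ∥ v → v ∥ w → u ∥ w
  ∥-trans u v w v≢0 u∥v v∥w with ∥⇒≡*ᵥ u v v≢0 u∥v | ∥⇒≡*ᵥ w v v≢0 (∥-sym v w v∥w)
  ... | k , refl | l , refl = *ᵥ-∥-*ᵥ k l v

  cross-*ᵥ : ∀ c u v → cross (c *ᵥ u) (c *ᵥ v) ≡ c * c * cross u v
  cross-*ᵥ c (x , y) (x′ , y′) = identity c x y x′ y′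
    where
    identity : ∀ c x y x′ y′ → c * x * (c * y′) - c * y * (c * x′) ≡ c * c * (x * y′ - y * x′)
    identity = solve-∀ ℚ-ring

  cramer : ∀ u v x → cross u v *ᵥ x ≡ cross x v *ᵥ u +ᵥ cross u x *ᵥ v
  cramer (u₁ , u₂) (v₁ , v₂) (x₁ , x₂) =
    cong₂ _,_ (first u₁ u₂ v₁ v₂ x₁ x₂) (second u₁ u₂ v₁ v₂ x₁ x₂)
    where
    first : ∀ u₁ u₂ v₁ v₂ x₁ x₂ → (u₁ * v₂ - u₂ * v₁) * x₁
      ≡ (x₁ * v₂ - x₂ * v₁) * u₁ + (u₁ * x₂ - u₂ * x₁) * v₁
    first = solve-∀ ℚ-ring
    second : ∀ u₁ u₂ v₁ v₂ x₁ x₂ → (u₁ * v₂ - u₂ * v₁) * x₂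
      ≡ (x₁ * v₂ - x₂ * v₁) * u₂ + (u₁ * x₂ - u₂ * x₁) * v₂
    second = solve-∀ ℚ-ring

  infixr 8 _·_
  _·_ : Mat → ℚ² → ℚ²
  mat a b c d · (x , y) = a * x + b * y , c * x + d * y

  mat-cong : ∀ {a b c d a′ b′ c′ d′} → a ≡ a′ → b ≡ b′ → c ≡ c′ → d ≡ d′ →
             mat a b c d ≡ mat a′ b′ c′ d′
  mat-cong refl refl refl refl = refl

  ·-⊗ : ∀ A B v → (A ⊗ B) · v ≡ A · B · v
  ·-⊗ (mat a b c d) (mat a′ b′ c′ d′) (x , y) =
    cong₂ _,_ (identity a b a′ b′ c′ d′ x y) (identity c d a′ b′ c′ d′ x y)
    where
    identity : ∀ p q a′ b′ c′ d′ x y → (p * a′ + q * c′) * x + (p * b′ + q * d′) * y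
                                    ≡ p * (a′ * x + b′ * y) + q * (c′ * x + d′ * y)
    identity = solve-∀ ℚ-ring

  ·-⊗₃ : ∀ A B C v → (A ⊗ B ⊗ C) · v ≡ A · B · C · v
  ·-⊗₃ A B C v = trans (·-⊗ (A ⊗ B) C v) (·-⊗ A B (C · v))

  ·-linear : ∀ A s t u v → A · (s *ᵥ u +ᵥ t *ᵥ v) ≡ s *ᵥ A · u +ᵥ t *ᵥ A · v
  ·-linear (mat a b c d) s t (x , y) (x′ , y′) =
    cong₂ _,_ (identity a b s t x y x′ y′) (identity c d s t x y x′ y′)
    where
    identity : ∀ p q s t x y x′ y′ → p * (s * x + t * x′) + q * (s * y + t * y′)
                                   ≡ s * (p * x + q * y) + t * (p * x′ + q * y′)
    identity = solve-∀ ℚ-ring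

  ·-*ᵥ : ∀ A k v → A · k *ᵥ v ≡ k *ᵥ A · v
  ·-*ᵥ (mat a b c d) k (x , y) = cong₂ _,_ (identity a b k x y) (identity c d k x y)
    where
    identity : ∀ p q k x y → p * (k * x) + q * (k * y) ≡ k * (p * x + q * y)
    identity = solve-∀ ℚ-ring

  ·-scal : ∀ k A v → scal k A · v ≡ k *ᵥ A · v
  ·-scal k (mat a b c d) (x , y) = cong₂ _,_ (identity k a b x y) (identity k c d x y)
    where
    identity : ∀ k p q x y → k * p * x + k * q * y ≡ k * (p * x + q * y)
    identity = solve-∀ ℚ-ring

  ·-0ᵥ : ∀ A → A · (0ℚ , 0ℚ) ≡ (0ℚ , 0ℚ)
  ·-0ᵥ (mat a b c d) = cong₂ _,_ (identity a b) (identity c d)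
    where
    identity : ∀ p q → p * 0ℚ + q * 0ℚ ≡ 0ℚ
    identity = solve-∀ ℚ-ring

  ·-e₁ : ∀ A → A · e₁ ≡ (m11 A , m21 A)
  ·-e₁ (mat a b c d) = cong₂ _,_ (identity a b) (identity c d)
    where
    identity : ∀ p q → p * 1ℚ + q * 0ℚ ≡ p
    identity = solve-∀ ℚ-ring

  ·-e₂ : ∀ A → A · (0ℚ , 1ℚ) ≡ (m12 A , m22 A)
  ·-e₂ (mat a b c d) = cong₂ _,_ (identity a b) (identity c d)
    where
    identity : ∀ p q → p * 0ℚ + q * 1ℚ ≡ q
    identity = solve-∀ ℚ-ring

  mat-ext : ∀ A B → (∀ v → A · v ≡ B · v) → A ≡ B
  mat-ext A B A≗B = columns (trans (sym (·-e₁ A)) (trans (A≗B e₁) (·-e₁ B)))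
                            (trans (sym (·-e₂ A)) (trans (A≗B (0ℚ , 1ℚ)) (·-e₂ B)))
    where
    columns : (m11 A , m21 A) ≡ (m11 B , m21 B) → (m12 A , m22 A) ≡ (m12 B , m22 B) → A ≡ B
    columns refl refl = refl

  cross-· : ∀ A u v → cross (A · u) (A · v) ≡ det A * cross u v
  cross-· (mat a b c d) (x , y) (x′ , y′) = identity a b c d x y x′ y′
    where
    identity : ∀ a b c d x y x′ y′ →
      (a * x + b * y) * (c * x′ + d * y′) - (c * x + d * y) * (a * x′ + b * y′)
        ≡ (a * d - b * c) * (x * y′ - y * x′)
    identity = solve-∀ ℚ-ring

  ·-∥ : ∀ A u v → u ∥ v → A · u ∥ A · v
  ·-∥ A u v u∥v = cross≡0⇒∥ (A · u) (A · v) (begin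
    cross (A · u) (A · v)  ≡⟨ cross-· A u v ⟩
    det A * cross u v      ≡⟨ cong (det A *_) (∥⇒cross≡0 u v u∥v) ⟩
    det A * 0ℚ             ≡⟨ ℚ.*-zeroʳ (det A) ⟩
    0ℚ                     ∎)
    where open ≡-Reasoning

  det-⊗ : ∀ A B → det (A ⊗ B) ≡ det A * det B
  det-⊗ (mat a b c d) (mat a′ b′ c′ d′) = identity a b c d a′ b′ c′ d′
    where
    identity : ∀ a b c d a′ b′ c′ d′ →
      (a * a′ + b * c′) * (c * b′ + d * d′) - (a * b′ + b * d′) * (c * a′ + d * c′)
        ≡ (a * d - b * c) * (a′ * d′ - b′ * c′)
    identity = solve-∀ ℚ-ring

  adj : Mat → Mat
  adj (mat a b c d) = mat d (- b) (- c) a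

  det-adj : ∀ A → det (adj A) ≡ det A
  det-adj (mat a b c d) = identity a b c d
    where
    identity : ∀ a b c d → d * a - - b * - c ≡ a * d - b * c
    identity = solve-∀ ℚ-ring

  adj-·ˡ : ∀ A v → adj A · A · v ≡ det A *ᵥ v
  adj-·ˡ (mat a b c d) (x , y) = cong₂ _,_ (first a b c d x y) (second a b c d x y)
    where
    first : ∀ a b c d x y → d * (a * x + b * y) + - b * (c * x + d * y) ≡ (a * d - b * c) * x
    first = solve-∀ ℚ-ring
    second : ∀ a b c d x y → - c * (a * x + b * y) + a * (c * x + d * y) ≡ (a * d - b * c) * y
    second = solve-∀ ℚ-ring

  adj-·ʳ : ∀ A v → A · adj A · v ≡ det A *ᵥ v
  adj-·ʳ (mat a b c d) (x , y) = cong₂ _,_ (first a b c d x y) (second a b c d x y)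
    where
    first : ∀ a b c d x y → a * (d * x + - b * y) + b * (- c * x + a * y) ≡ (a * d - b * c) * x
    first = solve-∀ ℚ-ring
    second : ∀ a b c d x y → c * (d * x + - b * y) + d * (- c * x + a * y) ≡ (a * d - b * c) * y
    second = solve-∀ ℚ-ring

  inv-·ˡ : ∀ A → det A ≢ 0ℚ → ∀ v → inv A · A · v ≡ v
  inv-·ˡ A detA≢0 v = begin
    inv A · A · v                       ≡⟨ ·-scal (qinv (det A)) (adj A) (A · v) ⟩
    qinv (det A) *ᵥ adj A · A · v       ≡⟨ cong (qinv (det A) *ᵥ_) (adj-·ˡ A v) ⟩
    qinv (det A) *ᵥ det A *ᵥ v          ≡⟨ qinv-*ᵥ-cancel (det A) v detA≢0 ⟩
    v                                   ∎
    where open ≡-Reasoning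

  inv-·ʳ : ∀ A → det A ≢ 0ℚ → ∀ v → A · inv A · v ≡ v
  inv-·ʳ A detA≢0 v = begin
    A · inv A · v                       ≡⟨ cong (A ·_) (·-scal (qinv (det A)) (adj A) v) ⟩
    A · qinv (det A) *ᵥ adj A · v       ≡⟨ ·-*ᵥ A (qinv (det A)) (adj A · v) ⟩
    qinv (det A) *ᵥ A · adj A · v       ≡⟨ cong (qinv (det A) *ᵥ_) (adj-·ʳ A v) ⟩
    qinv (det A) *ᵥ det A *ᵥ v          ≡⟨ qinv-*ᵥ-cancel (det A) v detA≢0 ⟩
    v                                   ∎
    where open ≡-Reasoning

  scal-identity : ∀ A → scal 1ℚ A ≡ A
  scal-identity (mat a b c d) = mat-cong (ℚ.*-identityˡ a) (ℚ.*-identityˡ b) (ℚ.*-identityˡ c) (ℚ.*-identityˡ d)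

  inv≡adj : ∀ A → det A ≡ 1ℚ → inv A ≡ adj A
  inv≡adj A det≡1 = trans (cong (λ k → scal (qinv k) (adj A)) det≡1) (scal-identity (adj A))

  ·-nonZero : ∀ A B v → (∀ w → B · A · w ≡ w) → NonZeroᵥ v → NonZeroᵥ (A · v)
  ·-nonZero A B v BA≗id v≢0 (Av₁≡0 , Av₂≡0) = v≢0 (cong proj₁ v≡0 , cong proj₂ v≡0)
    where
    open ≡-Reasoning
    v≡0 : v ≡ (0ℚ , 0ℚ)
    v≡0 = begin
      v              ≡⟨ BA≗id v ⟨
      B · A · v      ≡⟨ cong (B ·_) (cong₂ _,_ Av₁≡0 Av₂≡0) ⟩
      B · (0ℚ , 0ℚ)  ≡⟨ ·-0ᵥ B ⟩
      (0ℚ , 0ℚ)      ∎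

  ∥-transport : ∀ h x p q y → det h ≢ 0ℚ → NonZeroᵥ p → NonZeroᵥ q →
                x ∥ p → h · p ∥ q → y ∥ q → h · x ∥ y
  ∥-transport h x p q y deth≢0 p≢0 q≢0 x∥p hp∥q y∥q =
    ∥-trans (h · x) q y q≢0
      (∥-trans (h · x) (h · p) q (·-nonZero h (inv h) p (inv-·ˡ h deth≢0) p≢0) (·-∥ h x p x∥p) hp∥q)
      (∥-sym y q y∥q)

  tr-⊗-comm : ∀ A B → tr (A ⊗ B) ≡ tr (B ⊗ A)
  tr-⊗-comm (mat a b c d) (mat a′ b′ c′ d′) = identity a b c d a′ b′ c′ d′
    where
    identity : ∀ a b c d a′ b′ c′ d′ → (a * a′ + b * c′) + (c * b′ + d * d′)
                                     ≡ (a′ * a + b′ * c) + (c′ * b + d′ * d)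
    identity = solve-∀ ℚ-ring

  tr-similar : ∀ A B C → (∀ v → B · C · v ≡ v) → tr (C ⊗ A ⊗ B) ≡ tr A
  tr-similar A B C BC≗id = trans (tr-⊗-comm (C ⊗ A) B) (cong tr (mat-ext (B ⊗ (C ⊗ A)) A λ v → begin
    (B ⊗ (C ⊗ A)) · v  ≡⟨ ·-⊗ B (C ⊗ A) v ⟩
    B · (C ⊗ A) · v    ≡⟨ cong (B ·_) (·-⊗ C A v) ⟩
    B · C · A · v      ≡⟨ BC≗id (A · v) ⟩
    A · v              ∎))
    where open ≡-Reasoning

  cross-eigencombination : ∀ s t κ μ u v →
    cross (s *ᵥ κ *ᵥ u +ᵥ t *ᵥ μ *ᵥ v) (s *ᵥ u +ᵥ t *ᵥ v) ≡ s * t * (κ - μ) * cross u v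
  cross-eigencombination s t κ μ (u₁ , u₂) (v₁ , v₂) = identity s t κ μ u₁ u₂ v₁ v₂
    where
    identity : ∀ s t κ μ u₁ u₂ v₁ v₂ →
      (s * (κ * u₁) + t * (μ * v₁)) * (s * u₂ + t * v₂) - (s * (κ * u₂) + t * (μ * v₂)) * (s * u₁ + t * v₁)
        ≡ s * t * (κ - μ) * (u₁ * v₂ - u₂ * v₁)
    identity = solve-∀ ℚ-ring

  record Eigenvector (A : Mat) (κ : ℚ) (v : ℚ²) : Set where
    constructor eigenvector
    field
      nonZero  : NonZeroᵥ v
      equation : A · v ≡ κ *ᵥ v

  eigenvector⇒fixed : ∀ {A κ v} → Eigenvector A κ v → A · v ∥ v
  eigenvector⇒fixed {κ = κ} {v} (eigenvector _ Av≡κv) = subst (_∥ v) (sym Av≡κv) (*ᵥ-∥ κ v)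

  ∥-eigenvector : ∀ {A κ u v} → Eigenvector A κ v → NonZeroᵥ u → u ∥ v → Eigenvector A κ u
  ∥-eigenvector {A} {κ} {u} {v} (eigenvector v≢0 Av≡κv) u≢0 u∥v with ∥⇒≡*ᵥ u v v≢0 u∥v
  ... | k , refl = eigenvector u≢0 (begin
    A · k *ᵥ v    ≡⟨ ·-*ᵥ A k v ⟩
    k *ᵥ A · v    ≡⟨ cong (k *ᵥ_) Av≡κv ⟩
    k *ᵥ κ *ᵥ v   ≡⟨ *ᵥ-comm k κ v ⟩
    κ *ᵥ k *ᵥ v   ∎)
    where open ≡-Reasoning

  eigenvectors-∦ : ∀ {A κ μ u v} → κ ≢ μ → Eigenvector A κ u → Eigenvector A μ v → ¬ u ∥ v
  eigenvectors-∦ {κ = κ} {μ} {u} κ≢μ (eigenvector u≢0 Au≡κu) ev u∥v =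
    κ≢μ (*ᵥ-cancelʳ κ μ u u≢0 (trans (sym Au≡κu) (Eigenvector.equation (∥-eigenvector ev u≢0 u∥v))))

  fixed-cross-vanishes : ∀ {A κ μ u v} → Eigenvector A κ u → Eigenvector A μ v →
                         ∀ x → A · x ∥ x → cross x v * cross u x * (κ - μ) * cross u v ≡ 0ℚ
  fixed-cross-vanishes {A} {κ} {μ} {u} {v} (eigenvector _ Au≡κu) (eigenvector _ Av≡μv) x Ax∥x = begin
    s * t * (κ - μ) * c                   ≡⟨ cross-eigencombination s t κ μ u v ⟨
    cross (s *ᵥ κ *ᵥ u +ᵥ t *ᵥ μ *ᵥ v) y  ≡⟨ cong₂ (λ Au Av → cross (s *ᵥ Au +ᵥ t *ᵥ Av) y) Au≡κu Av≡μv ⟨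
    cross (s *ᵥ A · u +ᵥ t *ᵥ A · v) y    ≡⟨ cong (λ z → cross z y) (·-linear A s t u v) ⟨
    cross (A · y) y                       ≡⟨ cong (λ z → cross (A · z) z) (cramer u v x) ⟨
    cross (A · c *ᵥ x) (c *ᵥ x)           ≡⟨ cong (λ z → cross z (c *ᵥ x)) (·-*ᵥ A c x) ⟩
    cross (c *ᵥ A · x) (c *ᵥ x)           ≡⟨ cross-*ᵥ c (A · x) x ⟩
    c * c * cross (A · x) x               ≡⟨ cong (c * c *_) (∥⇒cross≡0 (A · x) x Ax∥x) ⟩
    c * c * 0ℚ                            ≡⟨ ℚ.*-zeroʳ (c * c) ⟩
    0ℚ                                    ∎
    where
    open ≡-Reasoning
    c = cross u v
    s = cross x v
    t = cross u x
    y = s *ᵥ u +ᵥ t *ᵥ v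

  fixed⇒∥-eigenvector : ∀ {A κ μ u v} → κ ≢ μ → Eigenvector A κ u → Eigenvector A μ v →
                        ∀ x → A · x ∥ x → x ∥ u ⊎ x ∥ v
  fixed⇒∥-eigenvector {κ = κ} {μ} {u} {v} κ≢μ eu ev x Ax∥x =
    [ stκμ≡0⇒∥ , c≡0⇒∥ ]′ (p*q≡0⇒p≡0∨q≡0 (s * t * (κ - μ)) c (fixed-cross-vanishes eu ev x Ax∥x))
    where
    c = cross u v
    s = cross x v
    t = cross u x
    st≡0⇒∥ : s * t ≡ 0ℚ → x ∥ u ⊎ x ∥ v
    st≡0⇒∥ st≡0 =
      [ (λ s≡0 → inj₂ (cross≡0⇒∥ x v s≡0)) , (λ t≡0 → inj₁ (∥-sym u x (cross≡0⇒∥ u x t≡0))) ]′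
        (p*q≡0⇒p≡0∨q≡0 s t st≡0)
    stκμ≡0⇒∥ : s * t * (κ - μ) ≡ 0ℚ → x ∥ u ⊎ x ∥ v
    stκμ≡0⇒∥ stκμ≡0 = [ st≡0⇒∥ , (λ κ-μ≡0 → ⊥-elim (κ≢μ (p-q≡0⇒p≡q κ μ κ-μ≡0))) ]′
                        (p*q≡0⇒p≡0∨q≡0 (s * t) (κ - μ) stκμ≡0)
    c≡0⇒∥ : c ≡ 0ℚ → x ∥ u ⊎ x ∥ v
    c≡0⇒∥ c≡0 = ⊥-elim (eigenvectors-∦ κ≢μ eu ev (cross≡0⇒∥ u v c≡0))

  upper-triangular-eigenvector₁ : ∀ α β δ → Eigenvector (mat α β 0ℚ δ) α e₁
  upper-triangular-eigenvector₁ α β δ =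
    eigenvector (λ ()) (cong₂ _,_ (first α β) (second δ α))
    where
    first : ∀ α β → α * 1ℚ + β * 0ℚ ≡ α * 1ℚ
    first = solve-∀ ℚ-ring
    second : ∀ δ α → 0ℚ * 1ℚ + δ * 0ℚ ≡ α * 0ℚ
    second = solve-∀ ℚ-ring

  upper-triangular-eigenvector₂ : ∀ α β δ → α ≢ δ → Eigenvector (mat α β 0ℚ δ) δ (β , δ - α)
  upper-triangular-eigenvector₂ α β δ α≢δ =
    eigenvector (λ (_ , δ-α≡0) → α≢δ (sym (p-q≡0⇒p≡q δ α δ-α≡0)))
                (cong₂ _,_ (first α β δ) (second α β δ))
    where
    first : ∀ α β δ → α * β + β * (δ - α) ≡ δ * β
    first = solve-∀ ℚ-ring
    second : ∀ α β δ → 0ℚ * β + δ * (δ - α) ≡ δ * (δ - α)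
    second = solve-∀ ℚ-ring

  conj : Mat → Mat → Mat
  conj g A = g ⊗ A ⊗ inv g

  conj-· : ∀ g A → det g ≢ 0ℚ → ∀ v → conj g A · g · v ≡ g · A · v
  conj-· g A detg≢0 v = trans (·-⊗₃ g A (inv g) (g · v)) (cong (λ w → g · A · w) (inv-·ˡ g detg≢0 v))

  conj-eigenvector : ∀ g {A κ v} → det g ≢ 0ℚ → Eigenvector A κ v → Eigenvector (conj g A) κ (g · v)
  conj-eigenvector g {A} {κ} {v} detg≢0 (eigenvector v≢0 Av≡κv) =
    eigenvector (·-nonZero g (inv g) v (inv-·ˡ g detg≢0) v≢0) (begin
      conj g A · g · v  ≡⟨ conj-· g A detg≢0 v ⟩
      g · A · v         ≡⟨ cong (g ·_) Av≡κv ⟩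
      g · κ *ᵥ v        ≡⟨ ·-*ᵥ g κ v ⟩
      κ *ᵥ g · v        ∎)
    where open ≡-Reasoning

  conj-eigenvector⁻¹ : ∀ g {A κ v} → det g ≢ 0ℚ → Eigenvector (conj g A) κ v → Eigenvector A κ (inv g · v)
  conj-eigenvector⁻¹ g {A} {κ} {v} detg≢0 (eigenvector v≢0 gAg⁻¹v≡κv) =
    eigenvector (·-nonZero (inv g) g v (inv-·ʳ g detg≢0) v≢0) (begin
      A · inv g · v                  ≡⟨ inv-·ˡ g detg≢0 (A · inv g · v) ⟨
      inv g · g · A · inv g · v      ≡⟨ cong (inv g ·_) (·-⊗₃ g A (inv g) v) ⟨
      inv g · conj g A · v           ≡⟨ cong (inv g ·_) gAg⁻¹v≡κv ⟩
      inv g · κ *ᵥ v                 ≡⟨ ·-*ᵥ (inv g) κ v ⟩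
      κ *ᵥ inv g · v                 ∎)
    where open ≡-Reasoning

  tr-conj : ∀ g A → det g ≢ 0ℚ → tr (conj g A) ≡ tr A
  tr-conj g A detg≢0 = tr-similar A (inv g) g (inv-·ˡ g detg≢0)

  conj-inv-cancel : ∀ S A → det S ≢ 0ℚ → conj S (inv S ⊗ A ⊗ S) ≡ A
  conj-inv-cancel S A detS≢0 = mat-ext (conj S (inv S ⊗ A ⊗ S)) A λ v → begin
    conj S (inv S ⊗ A ⊗ S) · v       ≡⟨ ·-⊗₃ S (inv S ⊗ A ⊗ S) (inv S) v ⟩
    S · (inv S ⊗ A ⊗ S) · inv S · v  ≡⟨ cong (S ·_) (·-⊗₃ (inv S) A S (inv S · v)) ⟩
    S · inv S · A · S · inv S · v    ≡⟨ inv-·ʳ S detS≢0 (A · S · inv S · v) ⟩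
    A · S · inv S · v                ≡⟨ cong (A ·_) (inv-·ʳ S detS≢0 v) ⟩
    A · v                            ∎
    where open ≡-Reasoning

  conj-scalar : ∀ g k → det g ≢ 0ℚ → conj g (mat k 0ℚ 0ℚ k) ≡ mat k 0ℚ 0ℚ k
  conj-scalar g k detg≢0 = mat-ext (conj g (mat k 0ℚ 0ℚ k)) (mat k 0ℚ 0ℚ k) λ v → begin
    conj g (mat k 0ℚ 0ℚ k) · v       ≡⟨ ·-⊗₃ g (mat k 0ℚ 0ℚ k) (inv g) v ⟩
    g · mat k 0ℚ 0ℚ k · inv g · v    ≡⟨ cong (g ·_) (·-scalar k (inv g · v)) ⟩
    g · k *ᵥ inv g · v               ≡⟨ ·-*ᵥ g k (inv g · v) ⟩
    k *ᵥ g · inv g · v               ≡⟨ cong (k *ᵥ_) (inv-·ʳ g detg≢0 v) ⟩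
    k *ᵥ v                           ≡⟨ ·-scalar k v ⟨
    mat k 0ℚ 0ℚ k · v                ∎
    where
    open ≡-Reasoning
    ·-scalar : ∀ k v → mat k 0ℚ 0ℚ k · v ≡ k *ᵥ v
    ·-scalar k (x , y) = cong₂ _,_ (first k x y) (second k x y)
      where
      first : ∀ k x y → k * x + 0ℚ * y ≡ k * x
      first = solve-∀ ℚ-ring
      second : ∀ k x y → 0ℚ * x + k * y ≡ k * y
      second = solve-∀ ℚ-ring

  commute-conj : ∀ g h P → det g ≢ 0ℚ → h ⊗ conj g P ≡ conj g P ⊗ h →
                 (inv g ⊗ h ⊗ g) ⊗ P ≡ P ⊗ (inv g ⊗ h ⊗ g)
  commute-conj g h P detg≢0 h-commutes = mat-ext ((inv g ⊗ h ⊗ g) ⊗ P) (P ⊗ (inv g ⊗ h ⊗ g)) λ v → begin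
    ((inv g ⊗ h ⊗ g) ⊗ P) · v                   ≡⟨ ·-⊗ (inv g ⊗ h ⊗ g) P v ⟩
    (inv g ⊗ h ⊗ g) · P · v                     ≡⟨ ·-⊗₃ (inv g) h g (P · v) ⟩
    inv g · h · g · P · v                       ≡⟨ cong (λ w → inv g · h · w) (conj-· g P detg≢0 v) ⟨
    inv g · h · conj g P · g · v                ≡⟨ cong (inv g ·_) (commute (g · v)) ⟩
    inv g · conj g P · h · g · v                ≡⟨ cong (λ w → inv g · conj g P · w) (inv-·ʳ g detg≢0 (h · g · v)) ⟨
    inv g · conj g P · g · inv g · h · g · v    ≡⟨ cong (inv g ·_) (conj-· g P detg≢0 (inv g · h · g · v)) ⟩
    inv g · g · P · inv g · h · g · v           ≡⟨ inv-·ˡ g detg≢0 (P · inv g · h · g · v) ⟩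
    P · inv g · h · g · v                       ≡⟨ cong (P ·_) (·-⊗₃ (inv g) h g v) ⟨
    P · (inv g ⊗ h ⊗ g) · v                     ≡⟨ ·-⊗ P (inv g ⊗ h ⊗ g) v ⟨
    (P ⊗ (inv g ⊗ h ⊗ g)) · v                   ∎
    where
    open ≡-Reasoning
    commute : ∀ w → h · conj g P · w ≡ conj g P · h · w
    commute w = trans (sym (·-⊗ h (conj g P) w)) (trans (cong (_· w) h-commutes) (·-⊗ (conj g P) h w))

  triangularise : ∀ S A α δ → det S ≢ 0ℚ → A · S · e₁ ≡ δ *ᵥ S · e₁ → tr A ≡ δ + α →
                  A ≡ conj S (mat δ (m12 (inv S ⊗ A ⊗ S)) 0ℚ α)
  triangularise S A α δ detS≢0 ASe₁≡δSe₁ trA≡δ+α =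
    trans (sym (conj-inv-cancel S A detS≢0)) (cong (conj S) Y≡triangular)
    where
    open ≡-Reasoning
    Y = inv S ⊗ A ⊗ S
    first-column : (m11 Y , m21 Y) ≡ δ *ᵥ e₁
    first-column = begin
      (m11 Y , m21 Y)        ≡⟨ ·-e₁ Y ⟨
      Y · e₁                 ≡⟨ ·-⊗₃ (inv S) A S e₁ ⟩
      inv S · A · S · e₁     ≡⟨ cong (inv S ·_) ASe₁≡δSe₁ ⟩
      inv S · δ *ᵥ S · e₁    ≡⟨ ·-*ᵥ (inv S) δ (S · e₁) ⟩
      δ *ᵥ inv S · S · e₁    ≡⟨ cong (δ *ᵥ_) (inv-·ˡ S detS≢0 e₁) ⟩
      δ *ᵥ e₁                ∎
    m11≡δ : m11 Y ≡ δ
    m11≡δ = trans (cong proj₁ first-column) (ℚ.*-identityʳ δ)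
    m22≡α : m22 Y ≡ α
    m22≡α = begin
      m22 Y                    ≡⟨ cancel (m11 Y) (m22 Y) ⟨
      (m11 Y + m22 Y) - m11 Y  ≡⟨ cong₂ _-_ (trans (tr-similar A S (inv S) (inv-·ʳ S detS≢0)) trA≡δ+α) m11≡δ ⟩
      (δ + α) - δ              ≡⟨ cancel δ α ⟩
      α                        ∎
      where
      cancel : ∀ p q → (p + q) - p ≡ q
      cancel = solve-∀ ℚ-ring
    Y≡triangular : Y ≡ mat δ (m12 Y) 0ℚ α
    Y≡triangular = mat-cong m11≡δ refl (trans (cong proj₂ first-column) (ℚ.*-zeroʳ δ)) m22≡α

  toMat : Matℤ → Mat
  toMat (matℤ a b c d) = mat (ℤ→ℚ a) (ℤ→ℚ b) (ℤ→ℚ c) (ℤ→ℚ d)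

  toMat-⊗ : ∀ M M′ → toMat (M ⊗ℤ M′) ≡ toMat M ⊗ toMat M′
  toMat-⊗ (matℤ a b c d) (matℤ a′ b′ c′ d′) =
    mat-cong (ℤ→ℚ-*+* a a′ b c′) (ℤ→ℚ-*+* a b′ b d′) (ℤ→ℚ-*+* c a′ d c′) (ℤ→ℚ-*+* c b′ d d′)

  toMat-det : ∀ M → det (toMat M) ≡ ℤ→ℚ (detℤ M)
  toMat-det (matℤ a b c d) =
    sym (trans (ℤ→ℚ-minus (a ℤ.* d) (b ℤ.* c)) (cong₂ _-_ (ℤ→ℚ-* a d) (ℤ→ℚ-* b c)))

  toMat-upperℤ : ∀ d b a → toMat (upperℤ d b a) ≡ mat (ℕ→ℚ d) (- ℕ→ℚ b) 0ℚ (ℕ→ℚ a)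
  toMat-upperℤ d b a = mat-cong refl (ℤ→ℚ-neg (+ b)) refl refl

  -- Γ₀(N) and, when gcd(n, N) = 1, Γ* are the parts of Δ₀ N of determinant 1 and n.
  Δ₀ : ℕ → Mat → Set
  Δ₀ N A = Σ Matℤ λ M → toMat M ≡ A × + N ∣ Matℤ.c M

  ∣⇒ℤ→ℚ-multiple : ∀ {N i} → + N ∣ i → Σ ℤ λ k → ℤ→ℚ i ≡ ℕ→ℚ N * ℤ→ℚ k
  ∣⇒ℤ→ℚ-multiple {N} (divides k refl) = k , trans (ℤ→ℚ-* k (+ N)) (ℚ.*-comm (ℤ→ℚ k) (ℕ→ℚ N))

  ℤ→ℚ-multiple⇒∣ : ∀ {N i} → (Σ ℤ λ k → ℤ→ℚ i ≡ ℕ→ℚ N * ℤ→ℚ k) → + N ∣ i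
  ℤ→ℚ-multiple⇒∣ {N} (k , i≡Nk) =
    divides k (ℤ→ℚ-injective (trans i≡Nk (trans (ℚ.*-comm (ℕ→ℚ N) (ℤ→ℚ k)) (sym (ℤ→ℚ-* k (+ N))))))

  InΓ₀⇒Δ₀ : ∀ N {g} → InΓ₀ N g → Δ₀ N g
  InΓ₀⇒Δ₀ N {mat _ _ _ _} (((α , refl) , (β , refl) , (γ , refl) , (δ , refl)) , _ , N∣γ) =
    matℤ α β γ δ , refl , ℤ→ℚ-multiple⇒∣ N∣γ

  Δ₀⇒InΓ₀ : ∀ N {g} → Δ₀ N g → det g ≡ 1ℚ → InΓ₀ N g
  Δ₀⇒InΓ₀ N (matℤ α β γ δ , refl , N∣γ) det≡1 =
    ((α , refl) , (β , refl) , (γ , refl) , (δ , refl)) , det≡1 , ∣⇒ℤ→ℚ-multiple N∣γ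

  Δ₀-⊗ : ∀ N {A B} → Δ₀ N A → Δ₀ N B → Δ₀ N (A ⊗ B)
  Δ₀-⊗ N (M@(matℤ a b c d) , refl , N∣c) (M′@(matℤ a′ b′ c′ d′) , refl , N∣c′) =
    M ⊗ℤ M′ , toMat-⊗ M M′ , ∣m∣n⇒∣m+n (∣m⇒∣m*n a′ N∣c) (∣n⇒∣m*n d N∣c′)

  Δ₀-adj : ∀ N {A} → Δ₀ N A → Δ₀ N (adj A)
  Δ₀-adj N (matℤ α β γ δ , refl , N∣γ) =
    matℤ δ (ℤ.- β) (ℤ.- γ) α , mat-cong refl (ℤ→ℚ-neg β) (ℤ→ℚ-neg γ) refl , ∣m⇒∣-m N∣γ

  Γ₀-⊗ : ∀ N {g h} → InΓ₀ N g → InΓ₀ N h → InΓ₀ N (g ⊗ h)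
  Γ₀-⊗ N {g} {h} g∈Γ₀@(_ , detg≡1 , _) h∈Γ₀@(_ , deth≡1 , _) =
    Δ₀⇒InΓ₀ N (Δ₀-⊗ N (InΓ₀⇒Δ₀ N g∈Γ₀) (InΓ₀⇒Δ₀ N h∈Γ₀))
      (trans (det-⊗ g h) (trans (cong₂ _*_ detg≡1 deth≡1) (ℚ.*-identityˡ 1ℚ)))

  Γ₀-inv : ∀ N {g} → InΓ₀ N g → InΓ₀ N (inv g)
  Γ₀-inv N {g} g∈Γ₀@(_ , det≡1 , _) = subst (InΓ₀ N) (sym (inv≡adj g det≡1))
    (Δ₀⇒InΓ₀ N (Δ₀-adj N (InΓ₀⇒Δ₀ N g∈Γ₀)) (trans (det-adj g) det≡1))

  Γ₀-det≢0 : ∀ N {g} → InΓ₀ N g → det g ≢ 0ℚ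
  Γ₀-det≢0 N (_ , det≡1 , _) det≡0 = ℚ.1≢0 (trans (sym det≡1) det≡0)

  InΓ*⇒Δ₀ : ∀ N n {A} → InΓ* N n A → Δ₀ N A × det A ≡ ℕ→ℚ n
  InΓ*⇒Δ₀ N n (a , d , b , g , _ , _ , a*d≡n , _ , g∈Γ₀@(_ , detg≡1 , _) , refl) =
    Δ₀-⊗ N (upperℤ d b a , toMat-upperℤ d b a , divides 0ℤ refl) (InΓ₀⇒Δ₀ N g∈Γ₀) , (begin
      det (R ⊗ g)          ≡⟨ det-⊗ R g ⟩
      det R * det g        ≡⟨ cong₂ _*_ (det-upper (ℕ→ℚ d) (ℕ→ℚ b) (ℕ→ℚ a)) detg≡1 ⟩
      ℕ→ℚ a * ℕ→ℚ d * 1ℚ   ≡⟨ ℚ.*-identityʳ (ℕ→ℚ a * ℕ→ℚ d) ⟩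
      ℕ→ℚ a * ℕ→ℚ d        ≡⟨ ℕ→ℚ-* a d ⟨
      ℕ→ℚ (a ℕ.* d)        ≡⟨ cong ℕ→ℚ a*d≡n ⟩
      ℕ→ℚ n                ∎)
    where
    open ≡-Reasoning
    R = mat (ℕ→ℚ d) (- ℕ→ℚ b) 0ℚ (ℕ→ℚ a)
    det-upper : ∀ d b a → d * a - - b * 0ℚ ≡ a * d
    det-upper = solve-∀ ℚ-ring

  Δ₀⇒InΓ* : ∀ N n {A} → 0 ℕ.< n → ℕ.gcd n N ≡ 1 → Δ₀ N A → det A ≡ ℕ→ℚ n → InΓ* N n A
  Δ₀⇒InΓ* N n 0<n n⊥N (M , refl , N∣c) det≡n =
    a , d , b , toMat g , 0<a , 0<d , a*d≡n , b<d ,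
    Δ₀⇒InΓ₀ N (g , refl , N∣lower-left) (trans (toMat-det g) (cong ℤ→ℚ det-g)) , (begin
      toMat M                                       ≡⟨ cong toMat factorisation ⟩
      toMat (upperℤ d b a ⊗ℤ g)                     ≡⟨ toMat-⊗ (upperℤ d b a) g ⟩
      toMat (upperℤ d b a) ⊗ toMat g                ≡⟨ cong (_⊗ toMat g) (toMat-upperℤ d b a) ⟩
      mat (ℕ→ℚ d) (- ℕ→ℚ b) 0ℚ (ℕ→ℚ a) ⊗ toMat g  ∎)
    where
    open ≡-Reasoning
    open HermiteDecomposition (hermite 0<n n⊥N M N∣c (ℤ→ℚ-injective (trans (sym (toMat-det M)) det≡n)))

  Γ*-conj : ∀ N n {g P} → 0 ℕ.< n → ℕ.gcd n N ≡ 1 → InΓ₀ N g → InΓ* N n P → InΓ* N n (conj g P)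
  Γ*-conj N n {g} {P} 0<n n⊥N g∈Γ₀@(_ , detg≡1 , _) P∈Γ* = Δ₀⇒InΓ* N n 0<n n⊥N
    (Δ₀-⊗ N (Δ₀-⊗ N (InΓ₀⇒Δ₀ N g∈Γ₀) ΔP) (InΓ₀⇒Δ₀ N g⁻¹∈Γ₀)) (begin
      det (g ⊗ P ⊗ inv g)              ≡⟨ det-⊗ (g ⊗ P) (inv g) ⟩
      det (g ⊗ P) * det (inv g)        ≡⟨ cong (_* det (inv g)) (det-⊗ g P) ⟩
      det g * det P * det (inv g)      ≡⟨ cong₂ (λ x y → x * det P * y) detg≡1 (proj₁ (proj₂ g⁻¹∈Γ₀)) ⟩
      1ℚ * det P * 1ℚ                  ≡⟨ unit (det P) ⟩
      det P                            ≡⟨ detP≡n ⟩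
      ℕ→ℚ n                            ∎)
    where
    open ≡-Reasoning
    g⁻¹∈Γ₀ = Γ₀-inv N g∈Γ₀
    ΔP = proj₁ (InΓ*⇒Δ₀ N n P∈Γ*)
    detP≡n = proj₂ (InΓ*⇒Δ₀ N n P∈Γ*)
    unit : ∀ p → 1ℚ * p * 1ℚ ≡ p
    unit = solve-∀ ℚ-ring

  TrivialΓ-conj : ∀ N {g P} → InΓ₀ N g → TrivialΓ N P → TrivialΓ N (conj g P)
  TrivialΓ-conj N {g} {P} g∈Γ₀ trivial h h∈Γ₀ h-commutes =
    Sum.map (conj-back 1ℚ) (conj-back (- 1ℚ))
      (trivial c (Γ₀-⊗ N (Γ₀-⊗ N (Γ₀-inv N g∈Γ₀) h∈Γ₀) g∈Γ₀) (commute-conj g h P detg≢0 h-commutes))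
    where
    detg≢0 = Γ₀-det≢0 N g∈Γ₀
    c = inv g ⊗ h ⊗ g
    conj-back : ∀ k → c ≡ mat k 0ℚ 0ℚ k → h ≡ mat k 0ℚ 0ℚ k
    conj-back k c≡k = trans (sym (conj-inv-cancel g h detg≢0)) (trans (cong (conj g) c≡k) (conj-scalar g k detg≢0))

  Hyperbolic-tr : ∀ n A B → tr A ≡ tr B → Hyperbolic n A → Hyperbolic n B
  Hyperbolic-tr n A B trA≡trB = subst (λ t → t * t ℚ.> ℕ→ℚ (4 ℕ.* n)) trA≡trB

  swapped-eigenlines⇒Γ₀Equiv : ∀ N {A κ μ u v g} → κ ≢ μ → Eigenvector A κ u → Eigenvector A μ v →
                               InΓ₀ N g → g · v ∥ u →
                               ∀ x y → Fixes A x → Fixes A y → ¬ x ≈P y → Γ₀Equiv N x y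
  swapped-eigenlines⇒Γ₀Equiv N {u = u} {v} {g} κ≢μ eu ev g∈Γ₀ gv∥u x y Ax∥x Ay∥y x≉y =
    classify (fixed⇒∥-eigenvector κ≢μ eu ev (vec x) Ax∥x) (fixed⇒∥-eigenvector κ≢μ eu ev (vec y) Ay∥y)
    where
    u≢0 = Eigenvector.nonZero eu
    v≢0 = Eigenvector.nonZero ev
    detg≢0 = Γ₀-det≢0 N g∈Γ₀
    g⁻¹u∥v : inv g · u ∥ v
    g⁻¹u∥v = ∥-sym v (inv g · u) (subst (_∥ inv g · u) (inv-·ˡ g detg≢0 v) (·-∥ (inv g) (g · v) u gv∥u))
    classify : vec x ∥ u ⊎ vec x ∥ v → vec y ∥ u ⊎ vec y ∥ v → Γ₀Equiv N x y
    classify (inj₁ x∥u) (inj₁ y∥u) = ⊥-elim (x≉y (∥-trans (vec x) u (vec y) u≢0 x∥u (∥-sym (vec y) u y∥u)))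
    classify (inj₂ x∥v) (inj₂ y∥v) = ⊥-elim (x≉y (∥-trans (vec x) v (vec y) v≢0 x∥v (∥-sym (vec y) v y∥v)))
    classify (inj₂ x∥v) (inj₁ y∥u) =
      g , g∈Γ₀ , ∥-transport g (vec x) v u (vec y) detg≢0 v≢0 u≢0 x∥v gv∥u y∥u
    classify (inj₁ x∥u) (inj₂ y∥v) =
      inv g , Γ₀-inv N g∈Γ₀ ,
      ∥-transport (inv g) (vec x) u v (vec y) (Γ₀-det≢0 N (Γ₀-inv N g∈Γ₀)) u≢0 v≢0 x∥u g⁻¹u∥v y∥v

  Mσ-positive : ∀ {w N} → 0 ℕ.< w → 0 ℕ.< N → 0 ℕ.< Mσ w N
  Mσ-positive {w} {N} 0<w 0<N = ℕ.n≢0⇒n>0 λ M≡0 → ℕ.≢-nonZero⁻¹ (w ℕ.* w ℕ.* N) (begin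
    w ℕ.* w ℕ.* N                          ≡⟨ gcd*lcm (w ℕ.* w) N ⟨
    ℕ.gcd (w ℕ.* w) N ℕ.* Mσ w N           ≡⟨ cong (ℕ.gcd (w ℕ.* w) N ℕ.*_) M≡0 ⟩
    ℕ.gcd (w ℕ.* w) N ℕ.* 0                ≡⟨ ℕ.*-zeroʳ (ℕ.gcd (w ℕ.* w) N) ⟩
    0                                      ∎)
    where
    open ≡-Reasoning
    instance
      _ = ℕ.>-nonZero 0<w
      _ = ℕ.>-nonZero 0<N
      _ = ℕ.m*n≢0 w w
      _ = ℕ.m*n≢0 (w ℕ.* w) N

  𝔞ℚ-nonZero : ∀ {u w} → 0 ℕ.< u → 0 ℕ.< w → 𝔞ℚ u w ≢ 0ℚ
  𝔞ℚ-nonZero {u} {w} 0<u 0<w =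
    p≢0∧q≢0⇒p*q≢0 (ℕ→ℚ u) (qinv (ℕ→ℚ w))
      (ℕ→ℚ-nonZero 0<u) (qinv-nonZero (ℕ→ℚ w) (ℕ→ℚ-nonZero 0<w))

  Sσ-det≢0 : ∀ {u w N} → 0 ℕ.< u → 0 ℕ.< w → 0 ℕ.< N → det (Sσ u w N) ≢ 0ℚ
  Sσ-det≢0 {u} {w} {N} 0<u 0<w 0<N detS≡0 =
    p≢0∧q≢0⇒p*q≢0 𝔞 (qinv (𝔞 * M)) 𝔞≢0 qinv≢0 (trans (sym (minus-zero 𝔞 (qinv (𝔞 * M)))) detS≡0)
    where
    𝔞 = 𝔞ℚ u w
    M = ℕ→ℚ (Mσ w N)
    𝔞≢0 : 𝔞 ≢ 0ℚ
    𝔞≢0 = 𝔞ℚ-nonZero 0<u 0<w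
    qinv≢0 : qinv (𝔞 * M) ≢ 0ℚ
    qinv≢0 = qinv-nonZero (𝔞 * M) (p≢0∧q≢0⇒p*q≢0 𝔞 M 𝔞≢0 (ℕ→ℚ-nonZero (Mσ-positive 0<w 0<N)))
    minus-zero : ∀ p q → p * q - 0ℚ * 1ℚ ≡ p * q
    minus-zero = solve-∀ ℚ-ring

  Sσ-e₁ : ∀ u w N → Sσ u w N · e₁ ≡ vec (ratPt (𝔞ℚ u w))
  Sσ-e₁ u w N = cong₂ _,_ (first (𝔞ℚ u w)) (second (qinv (𝔞ℚ u w * ℕ→ℚ (Mσ w N))))
    where
    first : ∀ p → p * 1ℚ + 0ℚ * 0ℚ ≡ p
    first = solve-∀ ℚ-ring
    second : ∀ k → 1ℚ * 1ℚ + k * 0ℚ ≡ 1ℚ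
    second = solve-∀ ℚ-ring

  module Setting (N u w a d : ℕ) (b : ℚ) (0<N : 0 ℕ.< N) (0<u : 0 ℕ.< u) (0<w : 0 ℕ.< w) (a≢d : a ≢ d) where

    S : Mat
    S = Sσ u w N

    P : Mat
    P = conjσ u w N a b d

    𝔞 : Pt
    𝔞 = ratPt (𝔞ℚ u w)

    α δ : ℚ
    α = ℕ→ℚ a
    δ = ℕ→ℚ d

    detS≢0 : det S ≢ 0ℚ
    detS≢0 = Sσ-det≢0 0<u 0<w 0<N

    α≢δ : α ≢ δ
    α≢δ α≡δ = a≢d (ℕ→ℚ-injective α≡δ)

    conjσ-eigenvector-𝔞 : ∀ x y z → Eigenvector (conjσ u w N x y z) (ℕ→ℚ x) (vec 𝔞)
    conjσ-eigenvector-𝔞 x y z = subst (Eigenvector (conjσ u w N x y z) (ℕ→ℚ x)) (Sσ-e₁ u w N)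
      (conj-eigenvector S detS≢0 (upper-triangular-eigenvector₁ (ℕ→ℚ x) y (ℕ→ℚ z)))

    𝔞-eigenvector : Eigenvector P α (vec 𝔞)
    𝔞-eigenvector = conjσ-eigenvector-𝔞 a b d

    second-eigenvector : Eigenvector P δ (S · (b , δ - α))
    second-eigenvector = conj-eigenvector S detS≢0 (upper-triangular-eigenvector₂ α b δ α≢δ)

    conjugate⇒fixed-points-Γ₀-equivalent : ∀ {b′ g} → InΓ₀ N g → g ⊗ P ⊗ inv g ≡ conjσ u w N d b′ a →
      ∀ x y → Fixes P x → Fixes P y → ¬ (x ≈P y) → Γ₀Equiv N x y
    conjugate⇒fixed-points-Γ₀-equivalent {b′} {g} g∈Γ₀ gPg⁻¹≡P′ =
      swapped-eigenlines⇒Γ₀Equiv N α≢δ 𝔞-eigenvector g⁻¹𝔞-eigenvector g∈Γ₀ gg⁻¹𝔞∥𝔞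
      where
      detg≢0 = Γ₀-det≢0 N g∈Γ₀
      g⁻¹𝔞-eigenvector : Eigenvector P δ (inv g · vec 𝔞)
      g⁻¹𝔞-eigenvector = conj-eigenvector⁻¹ g detg≢0
        (subst (λ Q → Eigenvector Q δ (vec 𝔞)) (sym gPg⁻¹≡P′) (conjσ-eigenvector-𝔞 d b′ a))
      gg⁻¹𝔞∥𝔞 : g · inv g · vec 𝔞 ∥ vec 𝔞
      gg⁻¹𝔞∥𝔞 = subst (_∥ vec 𝔞) (sym (inv-·ʳ g detg≢0 (vec 𝔞))) (∥-refl (vec 𝔞))

    conj-swapped : ∀ {g} → InΓ₀ N g → g · S · (b , δ - α) ∥ vec 𝔞 →
                   conj g P ≡ conjσ u w N d (m12 (inv S ⊗ conj g P ⊗ S)) a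
    conj-swapped {g} g∈Γ₀ gv∥𝔞 = triangularise S (conj g P) α δ detS≢0
      (subst (λ v → conj g P · v ≡ δ *ᵥ v) (sym (Sσ-e₁ u w N)) (Eigenvector.equation 𝔞-eigenvector′))
      (trans (tr-conj g P detg≢0) (trans (tr-conj S (mat α b 0ℚ δ) detS≢0) (ℚ.+-comm α δ)))
      where
      detg≢0 = Γ₀-det≢0 N g∈Γ₀
      𝔞-eigenvector′ : Eigenvector (conj g P) δ (vec 𝔞)
      𝔞-eigenvector′ = ∥-eigenvector (conj-eigenvector g detg≢0 second-eigenvector) (nz 𝔞)
        (∥-sym (g · S · (b , δ - α)) (vec 𝔞) gv∥𝔞)

    fixed-points-Γ₀-equivalent⇒conjugate : ∀ n → 0 ℕ.< n → ℕ.gcd n N ≡ 1 →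
      InΓ* N n P → Hyperbolic n P → TrivialΓ N P →
      (∀ x y → Fixes P x → Fixes P y → ¬ (x ≈P y) → Γ₀Equiv N x y) →
      Σ ℚ λ b′ → let P′ = conjσ u w N d b′ a
                 in InΓ* N n P′ × Hyperbolic n P′ × Fixes P′ 𝔞 × TrivialΓ N P′ ×
                    (Σ Mat λ g → InΓ₀ N g × g ⊗ P ⊗ inv g ≡ P′)
    fixed-points-Γ₀-equivalent⇒conjugate n 0<n n⊥N P∈Γ* hyperbolic trivial fixed-points-equivalent =
      b′ ,
      subst (InΓ* N n) P′≡conjσ (Γ*-conj N n 0<n n⊥N g∈Γ₀ P∈Γ*) ,
      Hyperbolic-tr n P (conjσ u w N d b′ a)
        (trans (sym (tr-conj g P (Γ₀-det≢0 N g∈Γ₀))) (cong tr P′≡conjσ)) hyperbolic ,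
      eigenvector⇒fixed (conjσ-eigenvector-𝔞 d b′ a) ,
      subst (TrivialΓ N) P′≡conjσ (TrivialΓ-conj N g∈Γ₀ trivial) ,
      g , g∈Γ₀ , P′≡conjσ
      where
      p₀ : Pt
      p₀ = pt _ _ (Eigenvector.nonZero second-eigenvector)
      p₀∼𝔞 : Γ₀Equiv N p₀ 𝔞
      p₀∼𝔞 = fixed-points-equivalent p₀ 𝔞
        (eigenvector⇒fixed second-eigenvector) (eigenvector⇒fixed 𝔞-eigenvector)
        (eigenvectors-∦ (λ δ≡α → α≢δ (sym δ≡α)) second-eigenvector 𝔞-eigenvector)
      g = proj₁ p₀∼𝔞
      g∈Γ₀ = proj₁ (proj₂ p₀∼𝔞)
      b′ = m12 (inv S ⊗ conj g P ⊗ S)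
      P′≡conjσ : conj g P ≡ conjσ u w N d b′ a
      P′≡conjσ = conj-swapped g∈Γ₀ (proj₂ (proj₂ p₀∼𝔞))

open import Data.Nat using (ℕ; _<_; _*_)
open import Data.Nat.GCD using (gcd)
open import Data.Nat.Divisibility using (_∣_)
open import Function.Bundles using (_⇔_; mk⇔)
open import Data.Nat.Properties using (<⇒≤)
open import Data.Product using (_,_)
open RationalMatrices using (module Setting)

lemma3p6 : (N n u w a d : ℕ) (b : ℚ) →
    1 < N → NotSquareFree N → 0 < n → gcd n N ≡ 1 →
    0 < u → 0 < w → gcd u w ≡ 1 → w ∣ N →
    0 < a → 0 < d → a * d ≡ n → a ≢ d →
    let P = conjσ u w N a b d
        𝔞 = ratPt (𝔞ℚ u w)
    in InΓ* N n P → Hyperbolic n P → Fixes P 𝔞 → TrivialΓ N P →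
       ((Σ ℚ λ b′ → let P′ = conjσ u w N d b′ a
                    in InΓ* N n P′ × Hyperbolic n P′ × Fixes P′ 𝔞 × TrivialΓ N P′ ×
                       (Σ Mat λ g → InΓ₀ N g × g ⊗ P ⊗ inv g ≡ P′))
        ⇔
        (∀ x y → Fixes P x → Fixes P y → ¬ (x ≈P y) → Γ₀Equiv N x y))
lemma3p6 N n u w a d b 1<N _ 0<n n⊥N 0<u 0<w _ _ _ _ _ a≢d P∈Γ* hyperbolic _ trivial =
  mk⇔ (λ (_ , _ , _ , _ , _ , _ , g∈Γ₀ , gPg⁻¹≡P′) →
         conjugate⇒fixed-points-Γ₀-equivalent g∈Γ₀ gPg⁻¹≡P′)
      (fixed-points-Γ₀-equivalent⇒conjugate n 0<n n⊥N P∈Γ* hyperbolic trivial)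
  where open Setting N u w a d b (<⇒≤ 1<N) 0<u 0<w a≢d
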